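{- Let $S=\Theta^*(S)$. Then, $S=\Theta(S)$. Conversely, if $S=\Theta(S)$ and $S$ is $\mathrm{Tr}$- and $\neg\mathrm{Tr}$-downwards closed, then $S=\Theta^*(S)$.
   Context: Setting: $\mathcal{L}_{\mathrm{Tr}}$ is the language of arithmetic (with function symbols for primitive recursive syntactic operations, written with a subdot, e.g. $\underset{\cdot}{\neg}$, $\underset{\cdot}{\vee}$, $\underset{\cdot}{\forall}$, and the substitution function $y(t/v)$) extended by a unary truth predicate $\mathrm{Tr}$; $\mathrm{PAT}$ is Peano arithmetic with induction for all of $\mathcal{L}_{\mathrm{Tr}}$; $\mathrm{Pr}_{\mathrm{PAT}}$ is its provability predicate; $t^\circ$ denotes the value of the closed term $t$; $\mathrm{True}_0$ is the set of codes of true arithmetic literals; $\ulcorner\varphi\urcorner$ is the numeral of the code $\#\varphi$. $\xi(x,X)$ is the arithmetical formula expressing one step of Strong Kleene truth: $x\in\mathrm{True}_0$, or $x=\underset{\cdot}{\neg}\underset{\cdot}{\neg}y$ with $y\in X$, or $x=y\underset{\cdot}{\vee}z$ with $y\in X$ or $z\in X$, or $x=\underset{\cdot}{\neg}(y\underset{\cdot}{\vee}z)$ with $\underset{\cdot}{\neg}y\in X$ and $\underset{\cdot}{\neg}z\in X$, the analogous dual clauses for $\underset{\cdot}{\wedge}$, $x=\underset{\cdot}{\forall}vy$ with $y(z/v)\in X$ for all $z$, $x=\underset{\cdot}{\neg}\underset{\cdot}{\forall}vy$ with $\underset{\cdot}{\neg}y(z/v)\in X$ for some $z$, the dual clauses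 for $\underset{\cdot}{\exists}$, $x=\underset{\cdot}{\mathrm{Tr}}(t)$ with $t^\circ\in X$, or $x=\underset{\cdot}{\neg}\underset{\cdot}{\mathrm{Tr}}(t)$ with $\underset{\cdot}{\neg}t^\circ\in X$ or $\neg\mathrm{Sent}(t^\circ)$. Then $\Theta(S):=\{n\in\omega\mid \mathbb{N}\vDash\exists y(\xi(y,X)\wedge\mathrm{Pr}_{\mathrm{PAT}}(y\underset{\cdot}{\rightarrow}x))[n,S]\}$. $\xi^*(x,X)$ is the disjunction of: $x\in\mathrm{True}_0$; $x=y\underset{\cdot}{\vee}z$ with $y\in X$ or $z\in X$; $x=y\underset{\cdot}{\wedge}z$ with $y\in X$ and $z\in X$; $x=\underset{\cdot}{\forall}vy$ with $y(t/v)\in X$ for all $t$; $x=\underset{\cdot}{\exists}vy$ with $y(t/v)\in X$ for some $t$; $x=\underset{\cdot}{\mathrm{Tr}}(t)$ with $t^\circ\in X$; $x=\underset{\cdot}{\neg}\underset{\cdot}{\mathrm{Tr}}(t)$ with $\underset{\cdot}{\neg}t^\circ\in X$ or $\neg\mathrm{Sent}(t^\circ)$; $x=t^\circ$ with $\mathrm{Sent}(t^\circ)$ and $\underset{\cdot}{\mathrm{Tr}}(t)\in X$; $x=\underset{\cdot}{\neg}t^\circ$ with $\mathrm{Sent}(\underset{\cdot}{\neg}t^\circ)$ and $\underset{\cdot}{\neg}\underset{\cdot}{\mathrm{Tr}}(t)\in X$. Then $\Theta^*(S):=\{n\in\omega\mid \mathbb{N}\vDash\exists y(\xi^*(y,X)\wedge\mathrm{Pr}_{\mathrm{PAT}}(y\underset{\cdot}{\rightarrow}x))[n,S]\}$.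 A set $S\subseteq\omega$ is $\mathrm{Tr}$-downwards closed iff $\#\mathrm{Tr}\ulcorner\varphi\urcorner\in S$ implies $\#\varphi\in S$, and $\neg\mathrm{Tr}$-downwards closed iff $\#\neg\mathrm{Tr}\ulcorner\varphi\urcorner\in S$ implies $\#\neg\varphi\in S$. -}

module Defs where

open import Data.Nat using (ℕ; zero; suc; _+_; _≡ᵇ_)
open import Data.Bool using (Bool; true; false; not; if_then_else_)
  renaming (_∧_ to _&&_; _∨_ to _||_)
open import Data.Fin using (Fin; toℕ)
open import Data.Vec using (Vec; []; _∷_; lookup; map)
open import Data.Product using (Σ; _×_; _,_)
open import Data.Sum using (_⊎_)
open import Relation.Binary.PropositionalEquality using (_≡_; _≢_)
open import Relation.Nullary using (¬_)

-- Function symbols: one for every primitive recursive function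
-- (given by a p.r. definition).  This covers 0, S, +, × and all the
-- primitive recursive syntactic operations of the language.

data PR : ℕ → Set where
  Zᵖ : PR 0
  Sᵖ : PR 1
  Pᵖ : ∀ {k} → Fin k → PR k
  Cᵖ : ∀ {k m} → PR m → Vec (PR k) m → PR k
  Rᵖ : ∀ {k} → PR k → PR (suc (suc k)) → PR (suc k)

evalPR  : ∀ {k} → PR k → Vec ℕ k → ℕ
evalPRs : ∀ {k m} → Vec (PR k) m → Vec ℕ k → Vec ℕ m
evalRec : ∀ {k} → PR k → PR (suc (suc k)) → ℕ → Vec ℕ k → ℕ
evalPR Zᵖ [] = 0
evalPR Sᵖ (x ∷ []) = suc x
evalPR (Pᵖ i) xs = lookup xs i
evalPR (Cᵖ f gs) xs = evalPR f (evalPRs gs xs)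
evalPR (Rᵖ f g) (y ∷ xs) = evalRec f g y xs
evalRec f g zero xs = evalPR f xs
evalRec f g (suc y) xs = evalPR g (y ∷ evalRec f g y xs ∷ xs)
evalPRs [] xs = []
evalPRs (g ∷ gs) xs = evalPR g xs ∷ evalPRs gs xs

data Term : Set where
  var : ℕ → Term
  fn  : ∀ {k} → PR k → Vec Term k → Term

infix  7 _≐_
infix  8 ∼_
infixr 6 _⋀_
infixr 5 _⋁_
infixr 4 _⇒_

data Formula : Set where
  _≐_ : Term → Term → Formula
  Tr  : Term → Formula
  ∼_  : Formula → Formula
  _⋁_ : Formula → Formula → Formula
  _⋀_ : Formula → Formula → Formula
  ∀'  : ℕ → Formula → Formula
  ∃'  : ℕ → Formula → Formula

_⇒_ : Formula → Formula → Formula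
φ ⇒ ψ = ∼ φ ⋁ ψ

zeroT : Term
zeroT = fn Zᵖ []

succT : Term → Term
succT t = fn Sᵖ (t ∷ [])

numeral : ℕ → Term
numeral zero = zeroT
numeral (suc n) = succT (numeral n)

tri : ℕ → ℕ
tri zero = zero
tri (suc n) = suc n + tri n

pair : ℕ → ℕ → ℕ
pair a b = tri (a + b) + b

codePR  : ∀ {k} → PR k → ℕ
codePR' : ∀ {k} → PR k → ℕ
codePRs : ∀ {k m} → Vec (PR k) m → ℕ
codePR {k} f = pair k (codePR' f)
codePR' Zᵖ = pair 0 0
codePR' Sᵖ = pair 1 0
codePR' (Pᵖ i) = pair 2 (toℕ i)
codePR' (Cᵖ f gs) = pair 3 (pair (codePR f) (codePRs gs))
codePR' (Rᵖ f g) = pair 4 (pair (codePR f) (codePR g))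
codePRs [] = 0
codePRs (g ∷ gs) = suc (pair (codePR g) (codePRs gs))

codeT  : Term → ℕ
codeTs : ∀ {k} → Vec Term k → ℕ
codeT (var i) = pair 0 i
codeT (fn f ts) = pair 1 (pair (codePR f) (codeTs ts))
codeTs [] = 0
codeTs (t ∷ ts) = suc (pair (codeT t) (codeTs ts))

negC : ℕ → ℕ
negC a = pair 2 a

orC : ℕ → ℕ → ℕ
orC a b = pair 3 (pair a b)

andC : ℕ → ℕ → ℕ
andC a b = pair 4 (pair a b)

impC : ℕ → ℕ → ℕ
impC a b = orC (negC a) b

# : Formula → ℕ
# (s ≐ t) = pair 0 (pair (codeT s) (codeT t))
# (Tr t) = pair 1 (codeT t)
# (∼ φ) = negC (# φ)
# (φ ⋁ ψ) = orC (# φ) (# ψ)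
# (φ ⋀ ψ) = andC (# φ) (# ψ)
# (∀' v φ) = pair 5 (pair v (# φ))
# (∃' v φ) = pair 6 (pair v (# φ))

⌜_⌝ : Formula → Term
⌜ φ ⌝ = numeral (# φ)

occT  : ℕ → Term → Bool
occTs : ∀ {k} → ℕ → Vec Term k → Bool
occT v (var i) = v ≡ᵇ i
occT v (fn f ts) = occTs v ts
occTs v [] = false
occTs v (t ∷ ts) = occT v t || occTs v ts

freeF : ℕ → Formula → Bool
freeF v (s ≐ t) = occT v s || occT v t
freeF v (Tr t) = occT v t
freeF v (∼ φ) = freeF v φ
freeF v (φ ⋁ ψ) = freeF v φ || freeF v ψ
freeF v (φ ⋀ ψ) = freeF v φ || freeF v ψ
freeF v (∀' w φ) = if v ≡ᵇ w then false else freeF v φ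
freeF v (∃' w φ) = if v ≡ᵇ w then false else freeF v φ

ClosedT : Term → Set
ClosedT t = ∀ v → occT v t ≡ false

Sentence : Formula → Set
Sentence φ = ∀ v → freeF v φ ≡ false

Sent : ℕ → Set
Sent n = Σ Formula λ φ → Sentence φ × (# φ ≡ n)

substT  : Term → ℕ → Term → Term
substTs : ∀ {k} → Term → ℕ → Vec Term k → Vec Term k
substT s v (var i) = if v ≡ᵇ i then s else var i
substT s v (fn f ts) = fn f (substTs s v ts)
substTs s v [] = []
substTs s v (t ∷ ts) = substT s v t ∷ substTs s v ts

_[_/_] : Formula → Term → ℕ → Formula
(t₁ ≐ t₂) [ s / v ] = substT s v t₁ ≐ substT s v t₂
Tr t [ s / v ] = Tr (substT s v t)
(∼ φ) [ s / v ] = ∼ (φ [ s / v ])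
(φ ⋁ ψ) [ s / v ] = (φ [ s / v ]) ⋁ (ψ [ s / v ])
(φ ⋀ ψ) [ s / v ] = (φ [ s / v ]) ⋀ (ψ [ s / v ])
∀' w φ [ s / v ] = if v ≡ᵇ w then ∀' w φ else ∀' w (φ [ s / v ])
∃' w φ [ s / v ] = if v ≡ᵇ w then ∃' w φ else ∃' w (φ [ s / v ])

freeFor : Term → ℕ → Formula → Bool
freeFor s v (_ ≐ _) = true
freeFor s v (Tr _) = true
freeFor s v (∼ φ) = freeFor s v φ
freeFor s v (φ ⋁ ψ) = freeFor s v φ && freeFor s v ψ
freeFor s v (φ ⋀ ψ) = freeFor s v φ && freeFor s v ψ
freeFor s v (∀' w φ) =
  if v ≡ᵇ w then true else (not (freeF v φ) || (not (occT w s) && freeFor s v φ))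
freeFor s v (∃' w φ) =
  if v ≡ᵇ w then true else (not (freeF v φ) || (not (occT w s) && freeFor s v φ))

evalT  : (ℕ → ℕ) → Term → ℕ
evalTs : ∀ {k} → (ℕ → ℕ) → Vec Term k → Vec ℕ k
evalT ρ (var i) = ρ i
evalT ρ (fn f ts) = evalPR f (evalTs ρ ts)
evalTs ρ [] = []
evalTs ρ (t ∷ ts) = evalT ρ t ∷ evalTs ρ ts

_° : Term → ℕ
t ° = evalT (λ _ → 0) t

data TrueLit : Formula → Set where
  pos : ∀ {s t} → ClosedT s → ClosedT t → s ° ≡ t ° → TrueLit (s ≐ t)
  neg : ∀ {s t} → ClosedT s → ClosedT t → s ° ≢ t ° → TrueLit (∼ (s ≐ t))

True₀ : ℕ → Set
True₀ n = Σ Formula λ φ → TrueLit φ × (# φ ≡ n)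

evalB : (Formula → Bool) → Formula → Bool
evalB V (∼ φ) = not (evalB V φ)
evalB V (φ ⋁ ψ) = evalB V φ || evalB V ψ
evalB V (φ ⋀ ψ) = evalB V φ && evalB V ψ
evalB V φ@(_ ≐ _) = V φ
evalB V φ@(Tr _) = V φ
evalB V φ@(∀' _ _) = V φ
evalB V φ@(∃' _ _) = V φ

Taut : Formula → Set
Taut φ = ∀ (V : Formula → Bool) → evalB V φ ≡ true

varsFrom : ℕ → (k : ℕ) → Vec Term k
varsFrom n zero = []
varsFrom n (suc k) = var n ∷ varsFrom (suc n) k

data PATAxiom : Formula → Set where
  ax-S≢0  : PATAxiom (∼ (succT (var 0) ≐ zeroT))
  ax-Sinj : PATAxiom ((succT (var 0) ≐ succT (var 1)) ⇒ (var 0 ≐ var 1))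
  ax-proj : ∀ {k} (i : Fin k) →
    PATAxiom (fn (Pᵖ i) (varsFrom 0 k) ≐ var (toℕ i))
  ax-comp : ∀ {k m} (f : PR m) (gs : Vec (PR k) m) →
    PATAxiom (fn (Cᵖ f gs) (varsFrom 0 k)
              ≐ fn f (map (λ g → fn g (varsFrom 0 k)) gs))
  ax-rec0 : ∀ {k} (f : PR k) (g : PR (suc (suc k))) →
    PATAxiom (fn (Rᵖ f g) (zeroT ∷ varsFrom 1 k) ≐ fn f (varsFrom 1 k))
  ax-recS : ∀ {k} (f : PR k) (g : PR (suc (suc k))) →
    PATAxiom (fn (Rᵖ f g) (succT (var 0) ∷ varsFrom 1 k)
              ≐ fn g (var 0 ∷ fn (Rᵖ f g) (var 0 ∷ varsFrom 1 k) ∷ varsFrom 1 k))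
  ax-ind  : ∀ (φ : Formula) (v : ℕ) →
    PATAxiom (((φ [ zeroT / v ]) ⋀ ∀' v (φ ⇒ (φ [ succT (var v) / v ]))) ⇒ ∀' v φ)

infix 2 PAT⊢_

data PAT⊢_ : Formula → Set where
  axiom    : ∀ {φ} → PATAxiom φ → PAT⊢ φ
  taut     : ∀ {φ} → Taut φ → PAT⊢ φ
  ∀-elim   : ∀ φ v t → freeFor t v φ ≡ true → PAT⊢ (∀' v φ ⇒ (φ [ t / v ]))
  ∃-intro  : ∀ φ v t → freeFor t v φ ≡ true → PAT⊢ ((φ [ t / v ]) ⇒ ∃' v φ)
  ≐-refl   : ∀ t → PAT⊢ (t ≐ t)
  ≐-subst  : ∀ φ v s t → freeFor s v φ ≡ true → freeFor t v φ ≡ true →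
             PAT⊢ ((s ≐ t) ⇒ ((φ [ s / v ]) ⇒ (φ [ t / v ])))
  mp       : ∀ {φ ψ} → PAT⊢ φ → PAT⊢ (φ ⇒ ψ) → PAT⊢ ψ
  gen      : ∀ {φ ψ v} → PAT⊢ (ψ ⇒ φ) → freeF v ψ ≡ false → PAT⊢ (ψ ⇒ ∀' v φ)
  ∃-elim   : ∀ {φ ψ v} → PAT⊢ (φ ⇒ ψ) → freeF v ψ ≡ false → PAT⊢ (∃' v φ ⇒ ψ)

-- Pr_PAT(n), read in the standard model: n codes a theorem of PAT
Pr : ℕ → Set
Pr n = Σ Formula λ χ → (# χ ≡ n) × (PAT⊢ χ)

-- ξ(x, X): one step of Strong Kleene truth (X a set of naturals)

data ξ (X : ℕ → Set) : ℕ → Set where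
  lit   : ∀ {n} → True₀ n → ξ X n
  dneg  : ∀ φ → X (# φ) → ξ X (# (∼ ∼ φ))
  or₁   : ∀ φ ψ → X (# φ) → ξ X (# (φ ⋁ ψ))
  or₂   : ∀ φ ψ → X (# ψ) → ξ X (# (φ ⋁ ψ))
  nor   : ∀ φ ψ → X (# (∼ φ)) → X (# (∼ ψ)) → ξ X (# (∼ (φ ⋁ ψ)))
  and   : ∀ φ ψ → X (# φ) → X (# ψ) → ξ X (# (φ ⋀ ψ))
  nand₁ : ∀ φ ψ → X (# (∼ φ)) → ξ X (# (∼ (φ ⋀ ψ)))
  nand₂ : ∀ φ ψ → X (# (∼ ψ)) → ξ X (# (∼ (φ ⋀ ψ)))
  all   : ∀ v φ → (∀ z → X (# (φ [ numeral z / v ]))) → ξ X (# (∀' v φ))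
  nall  : ∀ v φ z → X (# (∼ (φ [ numeral z / v ]))) → ξ X (# (∼ ∀' v φ))
  ex    : ∀ v φ z → X (# (φ [ numeral z / v ])) → ξ X (# (∃' v φ))
  nex   : ∀ v φ → (∀ z → X (# (∼ (φ [ numeral z / v ])))) → ξ X (# (∼ ∃' v φ))
  tr    : ∀ t → ClosedT t → X (t °) → ξ X (# (Tr t))
  ntr   : ∀ t → ClosedT t → (X (negC (t °)) ⊎ ¬ Sent (t °)) → ξ X (# (∼ Tr t))

data ξ* (X : ℕ → Set) : ℕ → Set where
  lit   : ∀ {n} → True₀ n → ξ* X n
  or₁   : ∀ φ ψ → X (# φ) → ξ* X (# (φ ⋁ ψ))
  or₂   : ∀ φ ψ → X (# ψ) → ξ* X (# (φ ⋁ ψ))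
  and   : ∀ φ ψ → X (# φ) → X (# ψ) → ξ* X (# (φ ⋀ ψ))
  all   : ∀ v φ → (∀ t → ClosedT t → X (# (φ [ t / v ]))) → ξ* X (# (∀' v φ))
  ex    : ∀ v φ t → ClosedT t → X (# (φ [ t / v ])) → ξ* X (# (∃' v φ))
  tr    : ∀ t → ClosedT t → X (t °) → ξ* X (# (Tr t))
  ntr   : ∀ t → ClosedT t → (X (negC (t °)) ⊎ ¬ Sent (t °)) → ξ* X (# (∼ Tr t))
  untr  : ∀ t → ClosedT t → Sent (t °) → X (# (Tr t)) → ξ* X (t °)
  unntr : ∀ t → ClosedT t → Sent (negC (t °)) → X (# (∼ Tr t)) → ξ* X (negC (t °))

Θ : (ℕ → Set) → (ℕ → Set)
Θ S n = Σ ℕ λ y → ξ S y × Pr (impC y n)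

Θ* : (ℕ → Set) → (ℕ → Set)
Θ* S n = Σ ℕ λ y → ξ* S y × Pr (impC y n)

infix 4 _≐ˢ_
_≐ˢ_ : (ℕ → Set) → (ℕ → Set) → Set
A ≐ˢ B = ∀ n → (A n → B n) × (B n → A n)

TrDownClosed : (ℕ → Set) → Set
TrDownClosed S = ∀ φ → Sentence φ → S (# (Tr ⌜ φ ⌝)) → S (# φ)

¬TrDownClosed : (ℕ → Set) → Set
¬TrDownClosed S = ∀ φ → Sentence φ → S (# (∼ Tr ⌜ φ ⌝)) → S (# (∼ φ))

module Submission where

-- A fixed point S of Θ[ G ] (G = ξ or ξ*) consists of formula codes and is closed under
-- PAT-provable implication: if A ∈ S and PAT ⊢ A → B, then A ∨ A ∈ G(S) by ∨-introduction
-- and PAT ⊢ A ∨ A → B.  The same clause, used for F instead of G, gives S ⊆ Θ[ F ](S), so S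
-- is a fixed point of Θ[ F ] as soon as F(S) ⊆ S.  For F = ξ, G = ξ*, the negative clauses
-- of ξ reduce to positive clauses of ξ* via tautologies and quantifier rules, and instances
-- at numerals give instances at every closed term t because PAT proves t equal to the
-- numeral of t°, evaluating each primitive recursive symbol by its defining axioms.  For
-- F = ξ*, G = ξ, the only clauses of ξ* missing from ξ are ∃-introduction, which is
-- PAT-provable, and the two clauses unpacking Tr, which are exactly Tr- and ¬Tr-downward
-- closure.

open import Defs
open import Data.Nat using (ℕ; zero; suc; _+_; _≡ᵇ_; _<_; _≤_; z≤n; s≤s)
open import Data.Nat.Properties
open import Data.Bool using (true; false; _∨_)
open import Data.Bool.Properties using (T-≡; ¬-not; ∨-zeroʳ; ∨-inverseˡ)
open import Data.Fin using (Fin; toℕ) renaming (zero to fzero; suc to fsuc)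
open import Data.Vec using (Vec; []; _∷_; lookup; map)
open import Data.Vec.Relation.Unary.All using (All; []; _∷_)
open import Data.Vec.Relation.Binary.Pointwise.Inductive as Pointwise using (Pointwise; []; _∷_)
open import Data.Product using (Σ-syntax; _×_; _,_; proj₁; proj₂)
open import Function using (Equivalence; _∘_)
open import Relation.Binary.PropositionalEquality
open import Relation.Binary.Definitions using (tri<; tri≈; tri>)
open import Relation.Nullary using (contradiction; yes; no)
open import Relation.Unary using (_⊆_)

variable
  a b k m m′ n v : ℕ
  s t u : Term
  φ A B : Formula

≡ᵇ-refl : ∀ n → (n ≡ᵇ n) ≡ true
≡ᵇ-refl n = Equivalence.to T-≡ (≡⇒≡ᵇ n n refl)

≡ᵇ-true⇒≡ : (m ≡ᵇ n) ≡ true → m ≡ n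
≡ᵇ-true⇒≡ {m} {n} e = ≡ᵇ⇒≡ m n (Equivalence.from T-≡ e)

≢⇒≡ᵇ-false : m ≢ n → (m ≡ᵇ n) ≡ false
≢⇒≡ᵇ-false m≢n = ¬-not (λ e → m≢n (≡ᵇ-true⇒≡ e))

∨≡false⇒≡false : ∀ {x y} → x ∨ y ≡ false → x ≡ false × y ≡ false
∨≡false⇒≡false {false} {false} _ = refl , refl

tri-mono-≤ : a ≤ b → tri a ≤ tri b
tri-mono-≤ z≤n = z≤n
tri-mono-≤ (s≤s a≤b) = +-mono-≤ (s≤s a≤b) (tri-mono-≤ a≤b)

pair-mono-< : ∀ a b c d → a + b < c + d → pair a b < pair c d
pair-mono-< a b c d lt = begin-strict
  tri (a + b) + b        ≤⟨ +-monoʳ-≤ (tri (a + b)) (m≤n+m b a) ⟩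
  tri (a + b) + (a + b)  ≡⟨ +-comm (tri (a + b)) (a + b) ⟩
  (a + b) + tri (a + b)  <⟨ n<1+n _ ⟩
  tri (suc (a + b))      ≤⟨ tri-mono-≤ lt ⟩
  tri (c + d)            ≤⟨ m≤m+n (tri (c + d)) d ⟩
  tri (c + d) + d        ∎
  where open ≤-Reasoning

pair-injective : ∀ a b c d → pair a b ≡ pair c d → a ≡ c × b ≡ d
pair-injective a b c d e with <-cmp (a + b) (c + d)
... | tri< lt _ _ = contradiction e (<⇒≢ (pair-mono-< a b c d lt))
... | tri> _ _ gt = contradiction (sym e) (<⇒≢ (pair-mono-< c d a b gt))
... | tri≈ _ a+b≡c+d _ = a≡c , b≡d
  where
  b≡d : b ≡ d
  b≡d = +-cancelˡ-≡ (tri (a + b)) b d (trans e (cong (λ x → tri x + d) (sym a+b≡c+d)))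
  a≡c : a ≡ c
  a≡c = +-cancelʳ-≡ b a c (trans a+b≡c+d (cong (c +_) (sym b≡d)))

∼-code : ∀ χ → # χ ≡ negC a → Σ[ φ ∈ Formula ] χ ≡ ∼ φ × # φ ≡ a
∼-code {a} (∼ φ)     e = φ , refl , proj₂ (pair-injective 2 (# φ) 2 a e)
∼-code {a} (s ≐ t)   e with () ← proj₁ (pair-injective 0 (pair (codeT s) (codeT t)) 2 a e)
∼-code {a} (Tr t)    e with () ← proj₁ (pair-injective 1 (codeT t) 2 a e)
∼-code {a} (φ ⋁ ψ)   e with () ← proj₁ (pair-injective 3 (pair (# φ) (# ψ)) 2 a e)
∼-code {a} (φ ⋀ ψ)   e with () ← proj₁ (pair-injective 4 (pair (# φ) (# ψ)) 2 a e)
∼-code {a} (∀' v φ)  e with () ← proj₁ (pair-injective 5 (pair v (# φ)) 2 a e)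
∼-code {a} (∃' v φ)  e with () ← proj₁ (pair-injective 6 (pair v (# φ)) 2 a e)

⋁-code : ∀ χ → # χ ≡ orC a b →
         Σ[ φ ∈ Formula ] Σ[ ψ ∈ Formula ] χ ≡ φ ⋁ ψ × # φ ≡ a × # ψ ≡ b
⋁-code {a} {b} (φ ⋁ ψ) e =
  φ , ψ , refl , pair-injective (# φ) (# ψ) a b (proj₂ (pair-injective 3 (pair (# φ) (# ψ)) 3 (pair a b) e))
⋁-code {a} {b} (s ≐ t)  e with () ← proj₁ (pair-injective 0 (pair (codeT s) (codeT t)) 3 (pair a b) e)
⋁-code {a} {b} (Tr t)   e with () ← proj₁ (pair-injective 1 (codeT t) 3 (pair a b) e)
⋁-code {a} {b} (∼ φ)    e with () ← proj₁ (pair-injective 2 (# φ) 3 (pair a b) e)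
⋁-code {a} {b} (φ ⋀ ψ)  e with () ← proj₁ (pair-injective 4 (pair (# φ) (# ψ)) 3 (pair a b) e)
⋁-code {a} {b} (∀' v φ) e with () ← proj₁ (pair-injective 5 (pair v (# φ)) 3 (pair a b) e)
⋁-code {a} {b} (∃' v φ) e with () ← proj₁ (pair-injective 6 (pair v (# φ)) 3 (pair a b) e)

ClosedTs : Vec Term k → Set
ClosedTs ts = ∀ v → occTs v ts ≡ false

All⇒ClosedTs : {ts : Vec Term k} → All ClosedT ts → ClosedTs ts
All⇒ClosedTs [] v = refl
All⇒ClosedTs (c ∷ cs) v rewrite c v = All⇒ClosedTs cs v

ClosedTs⇒All : {ts : Vec Term k} → ClosedTs ts → All ClosedT ts
ClosedTs⇒All {ts = []} c = []
ClosedTs⇒All {ts = t ∷ ts} c =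
  (λ v → proj₁ (∨≡false⇒≡false (c v))) ∷ ClosedTs⇒All (λ v → proj₂ (∨≡false⇒≡false (c v)))

numeral-closed : ∀ n → ClosedT (numeral n)
numeral-closed zero v = refl
numeral-closed (suc n) v rewrite numeral-closed n v = refl

substT-fresh : ∀ s v t → occT v t ≡ false → substT s v t ≡ t
substTs-fresh : ∀ s v (ts : Vec Term k) → occTs v ts ≡ false → substTs s v ts ≡ ts
substT-fresh s v (var i) e rewrite e = refl
substT-fresh s v (fn f ts) e = cong (fn f) (substTs-fresh s v ts e)
substTs-fresh s v [] e = refl
substTs-fresh s v (t ∷ ts) e =
  cong₂ _∷_ (substT-fresh s v t (proj₁ (∨≡false⇒≡false e)))
            (substTs-fresh s v ts (proj₂ (∨≡false⇒≡false e)))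

substT-closed : ClosedT u → substT s v u ≡ u
substT-closed {u} {s} {v} c = substT-fresh s v u (c v)

substTs-closed : {ts : Vec Term k} → All ClosedT ts → substTs s v ts ≡ ts
substTs-closed {s = s} {v} {ts} cs = substTs-fresh s v ts (All⇒ClosedTs cs v)

freeFor-closed : ClosedT t → ∀ v φ → freeFor t v φ ≡ true
freeFor-closed c v (_ ≐ _) = refl
freeFor-closed c v (Tr _) = refl
freeFor-closed c v (∼ φ) = freeFor-closed c v φ
freeFor-closed {t} c v (φ ⋁ ψ) rewrite freeFor-closed {t} c v φ | freeFor-closed {t} c v ψ = refl
freeFor-closed {t} c v (φ ⋀ ψ) rewrite freeFor-closed {t} c v φ | freeFor-closed {t} c v ψ = refl
freeFor-closed {t} c v (∀' w φ) with v ≡ᵇ w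
... | true = refl
... | false rewrite c w | freeFor-closed {t} c v φ = ∨-zeroʳ _
freeFor-closed {t} c v (∃' w φ) with v ≡ᵇ w
... | true = refl
... | false rewrite c w | freeFor-closed {t} c v φ = ∨-zeroʳ _

freeFor-self : ∀ v φ → freeFor (var v) v φ ≡ true
freeFor-self v (_ ≐ _) = refl
freeFor-self v (Tr _) = refl
freeFor-self v (∼ φ) = freeFor-self v φ
freeFor-self v (φ ⋁ ψ) rewrite freeFor-self v φ | freeFor-self v ψ = refl
freeFor-self v (φ ⋀ ψ) rewrite freeFor-self v φ | freeFor-self v ψ = refl
freeFor-self v (∀' w φ) with v ≟ w
... | yes refl rewrite ≡ᵇ-refl v = refl
... | no v≢w rewrite ≢⇒≡ᵇ-false v≢w | ≢⇒≡ᵇ-false (v≢w ∘ sym) | freeFor-self v φ = ∨-zeroʳ _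
freeFor-self v (∃' w φ) with v ≟ w
... | yes refl rewrite ≡ᵇ-refl v = refl
... | no v≢w rewrite ≢⇒≡ᵇ-false v≢w | ≢⇒≡ᵇ-false (v≢w ∘ sym) | freeFor-self v φ = ∨-zeroʳ _

substT-self : ∀ v t → substT (var v) v t ≡ t
substTs-self : ∀ v (ts : Vec Term k) → substTs (var v) v ts ≡ ts
substT-self v (var i) with v ≟ i
... | yes refl rewrite ≡ᵇ-refl v = refl
... | no v≢i rewrite ≢⇒≡ᵇ-false v≢i = refl
substT-self v (fn f ts) = cong (fn f) (substTs-self v ts)
substTs-self v [] = refl
substTs-self v (t ∷ ts) = cong₂ _∷_ (substT-self v t) (substTs-self v ts)

subst-self : ∀ v φ → φ [ var v / v ] ≡ φ
subst-self v (s ≐ t) = cong₂ _≐_ (substT-self v s) (substT-self v t)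
subst-self v (Tr t) = cong Tr (substT-self v t)
subst-self v (∼ φ) = cong ∼_ (subst-self v φ)
subst-self v (φ ⋁ ψ) = cong₂ _⋁_ (subst-self v φ) (subst-self v ψ)
subst-self v (φ ⋀ ψ) = cong₂ _⋀_ (subst-self v φ) (subst-self v ψ)
subst-self v (∀' w φ) with v ≡ᵇ w
... | true = refl
... | false = cong (∀' w) (subst-self v φ)
subst-self v (∃' w φ) with v ≡ᵇ w
... | true = refl
... | false = cong (∃' w) (subst-self v φ)

⇒-refl : ∀ φ → PAT⊢ (φ ⇒ φ)
⇒-refl φ = taut λ V → ∨-inverseˡ (evalB V φ)

⇒-weaken : PAT⊢ A → PAT⊢ (B ⇒ A)
⇒-weaken {A} {B} p = mp p (taut table)
  where
  table : Taut (A ⇒ B ⇒ A)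
  table V with evalB V A | evalB V B
  ... | false | _     = refl
  ... | true  | false = refl
  ... | true  | true  = refl

⋁-idem-⇒ : PAT⊢ (A ⇒ B) → PAT⊢ (A ⋁ A ⇒ B)
⋁-idem-⇒ {A} {B} p = mp p (taut table)
  where
  table : Taut ((A ⇒ B) ⇒ A ⋁ A ⇒ B)
  table V with evalB V A | evalB V B
  ... | false | _     = refl
  ... | true  | false = refl
  ... | true  | true  = refl

contraposition : PAT⊢ (A ⇒ B) → PAT⊢ (∼ B ⇒ ∼ A)
contraposition {A} {B} p = mp p (taut table)
  where
  table : Taut ((A ⇒ B) ⇒ ∼ B ⇒ ∼ A)
  table V with evalB V A | evalB V B
  ... | false | false = refl
  ... | false | true  = refl
  ... | true  | false = refl
  ... | true  | true  = refl

⇒∼-swap : PAT⊢ (A ⇒ ∼ B) → PAT⊢ (B ⇒ ∼ A)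
⇒∼-swap {A} {B} p = mp p (taut table)
  where
  table : Taut ((A ⇒ ∼ B) ⇒ B ⇒ ∼ A)
  table V with evalB V A | evalB V B
  ... | false | false = refl
  ... | false | true  = refl
  ... | true  | false = refl
  ... | true  | true  = refl

∼∼-intro : ∀ φ → PAT⊢ (φ ⇒ ∼ ∼ φ)
∼∼-intro φ = taut table
  where
  table : Taut (φ ⇒ ∼ ∼ φ)
  table V with evalB V φ
  ... | false = refl
  ... | true  = refl

∼⋁-intro : ∀ φ ψ → PAT⊢ (∼ φ ⋀ ∼ ψ ⇒ ∼ (φ ⋁ ψ))
∼⋁-intro φ ψ = taut table
  where
  table : Taut (∼ φ ⋀ ∼ ψ ⇒ ∼ (φ ⋁ ψ))
  table V with evalB V φ | evalB V ψ
  ... | false | false = refl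
  ... | false | true  = refl
  ... | true  | _     = refl

∼⋀-introˡ : ∀ φ ψ → PAT⊢ (∼ φ ⇒ ∼ (φ ⋀ ψ))
∼⋀-introˡ φ ψ = taut table
  where
  table : Taut (∼ φ ⇒ ∼ (φ ⋀ ψ))
  table V with evalB V φ | evalB V ψ
  ... | false | _     = refl
  ... | true  | false = refl
  ... | true  | true  = refl

∼⋀-introʳ : ∀ φ ψ → PAT⊢ (∼ ψ ⇒ ∼ (φ ⋀ ψ))
∼⋀-introʳ φ ψ = taut table
  where
  table : Taut (∼ ψ ⇒ ∼ (φ ⋀ ψ))
  table V with evalB V φ | evalB V ψ
  ... | false | false = refl
  ... | false | true  = refl
  ... | true  | false = refl
  ... | true  | true  = refl

⊢-gen : PAT⊢ φ → PAT⊢ (∀' v φ)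
⊢-gen {φ} {v} p = mp (≐-refl zeroT) (gen {φ} {zeroT ≐ zeroT} {v} (⇒-weaken p) refl)

⊢-inst : PAT⊢ φ → freeFor t v φ ≡ true → PAT⊢ (φ [ t / v ])
⊢-inst {φ} {t} {v} p free = mp (⊢-gen p) (∀-elim φ v t free)

∀-elim-self : ∀ v φ → PAT⊢ (∀' v φ ⇒ φ)
∀-elim-self v φ =
  subst (λ χ → PAT⊢ (∀' v φ ⇒ χ)) (subst-self v φ) (∀-elim φ v (var v) (freeFor-self v φ))

∀∼⇒∼∃ : ∀ v φ → PAT⊢ (∀' v (∼ φ) ⇒ ∼ ∃' v φ)
∀∼⇒∼∃ v φ = ⇒∼-swap (∃-elim (⇒∼-swap (∀-elim-self v (∼ φ))) v-not-free)
  where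
  v-not-free : freeF v (∼ ∀' v (∼ φ)) ≡ false
  v-not-free rewrite ≡ᵇ-refl v = refl

≐-leibniz : ClosedT s → ClosedT t → PAT⊢ (s ≐ t) → PAT⊢ (φ [ s / v ] ⇒ φ [ t / v ])
≐-leibniz {s} {t} {φ} {v} cs ct p = mp p (≐-subst φ v s t (freeFor-closed cs v φ) (freeFor-closed ct v φ))

≐-sym : ClosedT s → ClosedT t → PAT⊢ (s ≐ t) → PAT⊢ (t ≐ s)
≐-sym {s} {t} cs ct p = mp (≐-refl s) (subst₂ (λ x y → PAT⊢ (s ≐ x ⇒ t ≐ y))
  (substT-closed cs) (substT-closed cs) (≐-leibniz {φ = var 0 ≐ s} {v = 0} cs ct p))

≐-trans : ClosedT s → ClosedT t → ClosedT u → PAT⊢ (s ≐ t) → PAT⊢ (t ≐ u) → PAT⊢ (s ≐ u)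
≐-trans {s} {t} {u} cs ct cu p q = mp p (subst₂ (λ x y → PAT⊢ (x ≐ t ⇒ y ≐ u))
  (substT-closed cs) (substT-closed cs) (≐-leibniz {φ = s ≐ var 0} {v = 0} ct cu q))

≐-cong-head : ∀ {f : PR (suc k)} {ts : Vec Term k} → ClosedT s → ClosedT t → All ClosedT ts →
              PAT⊢ (s ≐ t) → PAT⊢ (fn f (s ∷ ts) ≐ fn f (t ∷ ts))
≐-cong-head {s = s} {t = t} {f = f} {ts} cs ct cts p = mp (≐-refl _) (subst₂ (λ x y → PAT⊢ (x ⇒ y))
  (cong₂ _≐_ (substT-closed lhs-closed) (head-instance s))
  (cong₂ _≐_ (substT-closed lhs-closed) (head-instance t))
  (≐-leibniz {φ = fn f (s ∷ ts) ≐ fn f (var 0 ∷ ts)} {v = 0} cs ct p))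
  where
  lhs-closed : ClosedT (fn f (s ∷ ts))
  lhs-closed = All⇒ClosedTs {ts = s ∷ ts} (cs ∷ cts)
  head-instance : ∀ u → substT u 0 (fn f (var 0 ∷ ts)) ≡ fn f (u ∷ ts)
  head-instance u = cong (λ us → fn f (u ∷ us)) (substTs-closed cts)

instT : Vec Term k → ℕ → Term → Term
instT []       n u = u
instT (t ∷ ts) n u = instT ts (suc n) (substT t n u)

instTs : Vec Term k → ℕ → Vec Term m → Vec Term m
instTs []       n us = us
instTs (t ∷ ts) n us = instTs ts (suc n) (substTs t n us)

⊢-instT : (ts : Vec Term k) (n : ℕ) → PAT⊢ (s ≐ t) → PAT⊢ (instT ts n s ≐ instT ts n t)
⊢-instT []       n p = p
⊢-instT (t ∷ ts) n p = ⊢-instT ts (suc n) (⊢-inst p refl)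

instT-fn : (ts : Vec Term k) (n : ℕ) (f : PR m) (us : Vec Term m) →
           instT ts n (fn f us) ≡ fn f (instTs ts n us)
instT-fn []       n f us = refl
instT-fn (t ∷ ts) n f us = instT-fn ts (suc n) f (substTs t n us)

instTs-[] : (ts : Vec Term k) (n : ℕ) → instTs ts n [] ≡ []
instTs-[] []       n = refl
instTs-[] (t ∷ ts) n = instTs-[] ts (suc n)

instTs-∷ : (ts : Vec Term k) (n : ℕ) (u : Term) (us : Vec Term m) →
           instTs ts n (u ∷ us) ≡ instT ts n u ∷ instTs ts n us
instTs-∷ []       n u us = refl
instTs-∷ (t ∷ ts) n u us = instTs-∷ ts (suc n) (substT t n u) (substTs t n us)

instT-closed : (ts : Vec Term k) (n : ℕ) → ClosedT u → instT ts n u ≡ u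
instT-closed []       n c = refl
instT-closed (t ∷ ts) n c = trans (cong (instT ts (suc n)) (substT-closed c)) (instT-closed ts (suc n) c)

substTs-varsFrom : n < m → substTs s n (varsFrom m k) ≡ varsFrom m k
substTs-varsFrom {k = zero} n<m = refl
substTs-varsFrom {m = m} {k = suc k} n<m rewrite ≢⇒≡ᵇ-false (<⇒≢ n<m) =
  cong (var m ∷_) (substTs-varsFrom (m<n⇒m<1+n n<m))

instT-head : (ts : Vec Term k) (n : ℕ) → ClosedT t → instT (t ∷ ts) n (var n) ≡ t
instT-head ts n c rewrite ≡ᵇ-refl n = instT-closed ts (suc n) c

instTs-varsFrom : (n : ℕ) {ts : Vec Term k} → All ClosedT ts → instTs ts n (varsFrom n k) ≡ ts
instTs-varsFrom-suc : (n : ℕ) {ts : Vec Term k} → All ClosedT ts →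
                      instTs (u ∷ ts) n (varsFrom (suc n) k) ≡ ts
instTs-varsFrom n [] = refl
instTs-varsFrom n {t ∷ ts} (c ∷ cs) =
  trans (instTs-∷ (t ∷ ts) n (var n) _) (cong₂ _∷_ (instT-head ts n c) (instTs-varsFrom-suc n cs))
instTs-varsFrom-suc {u = u} n {ts} cs =
  trans (cong (instTs ts (suc n)) (substTs-varsFrom (n<1+n n))) (instTs-varsFrom (suc n) cs)

instT-var : (n : ℕ) {ts : Vec Term k} → All ClosedT ts → (i : Fin k) →
            instT ts n (var (n + toℕ i)) ≡ lookup ts i
instT-var n {t ∷ ts} (c ∷ cs) fzero rewrite +-identityʳ n = instT-head ts n c
instT-var n {t ∷ ts} (c ∷ cs) (fsuc i)
  rewrite +-suc n (toℕ i) | ≢⇒≡ᵇ-false (<⇒≢ (s≤s (m≤m+n n (toℕ i)))) = instT-var (suc n) cs i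

instTs-map-fn : (ts : Vec Term k) (n : ℕ) (us : Vec Term m) (gs : Vec (PR m) m′) →
                instTs ts n (map (λ g → fn g us) gs) ≡ map (λ g → fn g (instTs ts n us)) gs
instTs-map-fn ts n us [] = instTs-[] ts n
instTs-map-fn ts n us (g ∷ gs) =
  trans (instTs-∷ ts n (fn g us) _) (cong₂ _∷_ (instT-fn ts n g us) (instTs-map-fn ts n us gs))

instT-fn-varsFrom : (n : ℕ) {ts : Vec Term k} (f : PR k) → All ClosedT ts →
                    instT ts n (fn f (varsFrom n k)) ≡ fn f ts
instT-fn-varsFrom n {ts} f cs = trans (instT-fn ts n f _) (cong (fn f) (instTs-varsFrom n cs))

axiom-instance : (ts : Vec Term k) (n : ℕ) {s′ t′ : Term} → PATAxiom (s ≐ t) →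
              instT ts n s ≡ s′ → instT ts n t ≡ t′ → PAT⊢ (s′ ≐ t′)
axiom-instance ts n ax refl refl = ⊢-instT ts n (axiom ax)

proj-instance : {ts : Vec Term k} → All ClosedT ts → (i : Fin k) → PAT⊢ (fn (Pᵖ i) ts ≐ lookup ts i)
proj-instance {ts = ts} cs i = axiom-instance ts 0 (ax-proj i) (instT-fn-varsFrom 0 (Pᵖ i) cs) (instT-var 0 cs i)

comp-instance : {ts : Vec Term k} (f : PR m) (gs : Vec (PR k) m) → All ClosedT ts →
                PAT⊢ (fn (Cᵖ f gs) ts ≐ fn f (map (λ g → fn g ts) gs))
comp-instance {k} {ts = ts} f gs cs =
  axiom-instance ts 0 (ax-comp f gs) (instT-fn-varsFrom 0 (Cᵖ f gs) cs) (begin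
    instT ts 0 (fn f (map (λ g → fn g vs) gs))
      ≡⟨ instT-fn ts 0 f _ ⟩
    fn f (instTs ts 0 (map (λ g → fn g vs) gs))
      ≡⟨ cong (fn f) (instTs-map-fn ts 0 vs gs) ⟩
    fn f (map (λ g → fn g (instTs ts 0 vs)) gs)
      ≡⟨ cong (λ us → fn f (map (λ g → fn g us) gs)) (instTs-varsFrom 0 cs) ⟩
    fn f (map (λ g → fn g ts) gs) ∎)
  where
  open ≡-Reasoning
  vs = varsFrom 0 k

rec₀-instance : {ts : Vec Term k} (f : PR k) (g : PR (suc (suc k))) → All ClosedT ts →
                PAT⊢ (fn (Rᵖ f g) (zeroT ∷ ts) ≐ fn f ts)
rec₀-instance {k} {ts} f g cs = axiom-instance ts 1 (ax-rec0 f g) (begin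
    instT ts 1 (fn R (zeroT ∷ vs))
      ≡⟨ instT-fn ts 1 R (zeroT ∷ vs) ⟩
    fn R (instTs ts 1 (zeroT ∷ vs))
      ≡⟨ cong (fn R) (instTs-∷ ts 1 zeroT vs) ⟩
    fn R (instT ts 1 zeroT ∷ instTs ts 1 vs)
      ≡⟨ cong (fn R) (cong₂ _∷_ (instT-closed ts 1 (numeral-closed 0)) (instTs-varsFrom 1 cs)) ⟩
    fn R (zeroT ∷ ts) ∎)
  (instT-fn-varsFrom 1 f cs)
  where
  open ≡-Reasoning
  R = Rᵖ f g
  vs = varsFrom 1 k

recₛ-instance : {ts : Vec Term k} (f : PR k) (g : PR (suc (suc k))) → ClosedT u → All ClosedT ts →
                PAT⊢ (fn (Rᵖ f g) (succT u ∷ ts) ≐ fn g (u ∷ fn (Rᵖ f g) (u ∷ ts) ∷ ts))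
recₛ-instance {k} {u} {ts} f g c cs = axiom-instance us 0 (ax-recS f g) (begin
    instT us 0 (fn R (succT (var 0) ∷ vs))
      ≡⟨ instT-fn us 0 R (succT (var 0) ∷ vs) ⟩
    fn R (instTs us 0 (succT (var 0) ∷ vs))
      ≡⟨ cong (fn R) (instTs-∷ us 0 (succT (var 0)) vs) ⟩
    fn R (instT ts 1 (succT u) ∷ instTs us 0 vs)
      ≡⟨ cong (fn R) (cong₂ _∷_ (instT-closed ts 1 succ-closed) (instTs-varsFrom-suc 0 cs)) ⟩
    fn R (succT u ∷ ts) ∎) (begin
    instT us 0 (fn g (var 0 ∷ Rvs ∷ vs))
      ≡⟨ instT-fn us 0 g (var 0 ∷ Rvs ∷ vs) ⟩
    fn g (instTs us 0 (var 0 ∷ Rvs ∷ vs))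
      ≡⟨ cong (fn g) (instTs-∷ us 0 (var 0) (Rvs ∷ vs)) ⟩
    fn g (instT us 0 (var 0) ∷ instTs us 0 (Rvs ∷ vs))
      ≡⟨ cong (fn g) (cong₂ _∷_ (instT-head ts 0 c) (instTs-∷ us 0 Rvs vs)) ⟩
    fn g (u ∷ instT us 0 Rvs ∷ instTs us 0 vs)
      ≡⟨ cong (λ xs → fn g (u ∷ xs))
           (cong₂ _∷_ (instT-fn-varsFrom 0 R (c ∷ cs)) (instTs-varsFrom-suc 0 cs)) ⟩
    fn g (u ∷ fn R (u ∷ ts) ∷ ts) ∎)
  where
  open ≡-Reasoning
  R = Rᵖ f g
  us = u ∷ ts
  vs = varsFrom 1 k
  Rvs = fn R (varsFrom 0 (suc k))
  succ-closed : ClosedT (succT u)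
  succ-closed = All⇒ClosedTs {ts = u ∷ []} (c ∷ [])

infix 4 _⇓_
record _⇓_ (t : Term) (n : ℕ) : Set where
  constructor mk⇓
  field
    closed  : ClosedT t
    ⊢≐numeral : PAT⊢ (t ≐ numeral n)
open _⇓_

numeral-⇓ : ∀ n → numeral n ⇓ n
numeral-⇓ n = mk⇓ (numeral-closed n) (≐-refl (numeral n))

⇓-closed : {ts : Vec Term k} {xs : Vec ℕ k} → Pointwise _⇓_ ts xs → All ClosedT ts
⇓-closed [] = []
⇓-closed (p ∷ ps) = closed p ∷ ⇓-closed ps

args-closed : (f : PR k) {ts : Vec Term k} {xs : Vec ℕ k} → Pointwise _⇓_ ts xs → ClosedT (fn f ts)
args-closed f ps = All⇒ClosedTs (⇓-closed ps)

⇓-step : ClosedT t → PAT⊢ (t ≐ u) → u ⇓ n → t ⇓ n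
⇓-step {n = n} ct p (mk⇓ cu q) = mk⇓ ct (≐-trans ct cu (numeral-closed n) p q)

fn-⇓ : (f : PR k) {ts : Vec Term k} {xs : Vec ℕ k} → Pointwise _⇓_ ts xs → fn f ts ⇓ evalPR f xs
fns-⇓ : (gs : Vec (PR k) m) {ts : Vec Term k} {xs : Vec ℕ k} → Pointwise _⇓_ ts xs →
        Pointwise _⇓_ (map (λ g → fn g ts) gs) (evalPRs gs xs)
rec-⇓ : (f : PR k) (g : PR (suc (suc k))) (y : ℕ) {ts : Vec Term k} {xs : Vec ℕ k} →
        Pointwise _⇓_ ts xs →
        fn (Rᵖ f g) (numeral y ∷ ts) ⇓ evalRec f g y xs

fn-⇓ Zᵖ [] = numeral-⇓ 0
fn-⇓ Sᵖ {xs = x ∷ []} ps@(mk⇓ c p ∷ []) = mk⇓ (args-closed Sᵖ ps) (≐-cong-head c (numeral-closed x) [] p)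
fn-⇓ (Pᵖ i) ps = ⇓-step (args-closed (Pᵖ i) ps) (proj-instance (⇓-closed ps) i) (Pointwise.lookup ps i)
fn-⇓ (Cᵖ f gs) ps =
  ⇓-step (args-closed (Cᵖ f gs) ps) (comp-instance f gs (⇓-closed ps)) (fn-⇓ f (fns-⇓ gs ps))
fn-⇓ (Rᵖ f g) {xs = y ∷ _} ps@(mk⇓ c p ∷ ps′) = ⇓-step (args-closed (Rᵖ f g) ps)
  (≐-cong-head c (numeral-closed y) (⇓-closed ps′) p) (rec-⇓ f g y ps′)

fns-⇓ [] ps = []
fns-⇓ (g ∷ gs) ps = fn-⇓ g ps ∷ fns-⇓ gs ps

rec-⇓ f g zero ps = ⇓-step (args-closed (Rᵖ f g) (numeral-⇓ 0 ∷ ps))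
  (rec₀-instance f g (⇓-closed ps)) (fn-⇓ f ps)
rec-⇓ f g (suc y) ps = ⇓-step (args-closed (Rᵖ f g) (numeral-⇓ (suc y) ∷ ps))
  (recₛ-instance f g (numeral-closed y) (⇓-closed ps)) (fn-⇓ g (numeral-⇓ y ∷ rec-⇓ f g y ps ∷ ps))

closed-⇓ : ∀ t → ClosedT t → t ⇓ t °
closedTs-⇓ : (ts : Vec Term k) → All ClosedT ts → Pointwise _⇓_ ts (evalTs (λ _ → 0) ts)
closed-⇓ (var i) c with () ← trans (sym (≡ᵇ-refl i)) (c i)
closed-⇓ (fn f ts) c = fn-⇓ f (closedTs-⇓ ts (ClosedTs⇒All c))
closedTs-⇓ [] [] = []
closedTs-⇓ (t ∷ ts) (c ∷ cs) = closed-⇓ t c ∷ closedTs-⇓ ts cs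

to-numeral : ClosedT t → PAT⊢ (φ [ t / v ] ⇒ φ [ numeral (t °) / v ])
to-numeral {t} {φ} {v} c = ≐-leibniz {φ = φ} {v} c (numeral-closed (t °)) (⊢≐numeral (closed-⇓ t c))

from-numeral : ClosedT t → PAT⊢ (φ [ numeral (t °) / v ] ⇒ φ [ t / v ])
from-numeral {t} {φ} {v} c =
  ≐-leibniz {φ = φ} {v} (numeral-closed (t °)) c (≐-sym c (numeral-closed (t °)) (⊢≐numeral (closed-⇓ t c)))

Pr-⇒ : Pr (impC a b) → Σ[ A ∈ Formula ] Σ[ B ∈ Formula ] # A ≡ a × # B ≡ b × PAT⊢ (A ⇒ B)
Pr-⇒ {a} {b} (χ , e , p) with ⋁-code {negC a} {b} χ e
... | ∼A , B , refl , e∼A , refl with ∼-code {a} ∼A e∼A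
... | A , refl , refl = A , B , refl , refl , p

⇒-Pr : PAT⊢ (A ⇒ B) → Pr (impC (# A) (# B))
⇒-Pr {A} {B} p = (A ⇒ B) , refl , p

-- Θ and Θ* are Θ[ ξ ] and Θ[ ξ* ] up to unfolding.
Θ[_] : ((ℕ → Set) → ℕ → Set) → (ℕ → Set) → ℕ → Set
Θ[ F ] S n = Σ[ y ∈ ℕ ] F S y × Pr (impC y n)

OrIntro : ((ℕ → Set) → ℕ → Set) → Set₁
OrIntro F = ∀ {X} φ ψ → X (# φ) → F X (# (φ ⋁ ψ))

DeductivelyClosed : (ℕ → Set) → Set
DeductivelyClosed S = ∀ {A B} → PAT⊢ (A ⇒ B) → S (# A) → S (# B)

variable
  F G : (ℕ → Set) → ℕ → Set
  S : ℕ → Set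

Θ⊆⇒deductivelyClosed : OrIntro F → Θ[ F ] S ⊆ S → DeductivelyClosed S
Θ⊆⇒deductivelyClosed orF Θ⊆S {A} p s = Θ⊆S (# (A ⋁ A) , orF A A s , ⇒-Pr (⋁-idem-⇒ p))

closed⇒Θ⊆ : DeductivelyClosed S → F S ⊆ S → Θ[ F ] S ⊆ S
closed⇒Θ⊆ ⊢-closed F⊆S {n} (y , x , pr) with Pr-⇒ {y} {n} pr
... | A , B , refl , refl , p = ⊢-closed p (F⊆S x)

⊆Θ-transfer : OrIntro F → S ⊆ Θ[ G ] S → S ⊆ Θ[ F ] S
⊆Θ-transfer orF S⊆Θ {n} s with S⊆Θ s
... | y , _ , pr with Pr-⇒ {y} {n} pr
... | A , B , _ , refl , _ = # (B ⋁ B) , orF B B s , ⇒-Pr (⋁-idem-⇒ (⇒-refl B))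

≐ˢ-⊆ : {P Q : ℕ → Set} → P ≐ˢ Q → P ⊆ Q
≐ˢ-⊆ P≐Q {n} = proj₁ (P≐Q n)

≐ˢ-⊇ : {P Q : ℕ → Set} → P ≐ˢ Q → Q ⊆ P
≐ˢ-⊇ P≐Q {n} = proj₂ (P≐Q n)

fixed-point-transfer : OrIntro F → OrIntro G → S ≐ˢ Θ[ G ] S → F S ⊆ S → S ≐ˢ Θ[ F ] S
fixed-point-transfer {F} {G} orF orG fix F⊆S n =
    ⊆Θ-transfer {F = F} {G = G} orF (≐ˢ-⊆ fix)
  , closed⇒Θ⊆ {F = F} (Θ⊆⇒deductivelyClosed {F = G} orG (≐ˢ-⊇ fix)) F⊆S

Tr-down : TrDownClosed S → Sent m → S (# (Tr (numeral m))) → S m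
Tr-down down (φ , sentence , refl) = down φ sentence

∼Tr-down : ¬TrDownClosed S → Sent (negC m) → S (# (∼ Tr (numeral m))) → S (negC m)
∼Tr-down {m = m} down (ψ , sentence , e) with ∼-code {m} ψ e
... | φ , refl , refl = down φ sentence

Θ*⊆⇒ξ⊆ : Θ* S ⊆ S → ξ S ⊆ S
Θ*⊆⇒ξ⊆ {S} Θ*⊆S = go
  where
  ⊢-closed : DeductivelyClosed S
  ⊢-closed = Θ⊆⇒deductivelyClosed {F = ξ*} or₁ Θ*⊆S
  ξ*-step : ∀ φ → ξ* S (# φ) → S (# φ)
  ξ*-step φ x = Θ*⊆S (# φ , x , ⇒-Pr (⇒-refl φ))
  closed-instances : ∀ v φ → (∀ z → S (# (φ [ numeral z / v ]))) → ∀ t → ClosedT t → S (# (φ [ t / v ]))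
  closed-instances v φ f t c = ⊢-closed (from-numeral {φ = φ} {v} c) (f (t °))
  go : ξ S ⊆ S
  go (lit (φ , l , refl)) = ξ*-step φ (lit (φ , l , refl))
  go (dneg φ s) = ⊢-closed (∼∼-intro φ) s
  go (or₁ φ ψ s) = ξ*-step (φ ⋁ ψ) (or₁ φ ψ s)
  go (or₂ φ ψ s) = ξ*-step (φ ⋁ ψ) (or₂ φ ψ s)
  go (nor φ ψ s s′) = ⊢-closed (∼⋁-intro φ ψ) (ξ*-step (∼ φ ⋀ ∼ ψ) (and (∼ φ) (∼ ψ) s s′))
  go (and φ ψ s s′) = ξ*-step (φ ⋀ ψ) (and φ ψ s s′)
  go (nand₁ φ ψ s) = ⊢-closed (∼⋀-introˡ φ ψ) s
  go (nand₂ φ ψ s) = ⊢-closed (∼⋀-introʳ φ ψ) s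
  go (all v φ f) = ξ*-step (∀' v φ) (all v φ (closed-instances v φ f))
  go (nall v φ z s) =
    ⊢-closed (contraposition (∀-elim φ v (numeral z) (freeFor-closed (numeral-closed z) v φ))) s
  go (ex v φ z s) = ξ*-step (∃' v φ) (ex v φ (numeral z) (numeral-closed z) s)
  go (nex v φ f) =
    ⊢-closed (∀∼⇒∼∃ v φ) (ξ*-step (∀' v (∼ φ)) (all v (∼ φ) (closed-instances v (∼ φ) f)))
  go (tr t c s) = ξ*-step (Tr t) (tr t c s)
  go (ntr t c s) = ξ*-step (∼ Tr t) (ntr t c s)

Θ⊆⇒ξ*⊆ : Θ S ⊆ S → TrDownClosed S → ¬TrDownClosed S → ξ* S ⊆ S
Θ⊆⇒ξ*⊆ {S} Θ⊆S down ¬down = go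
  where
  ⊢-closed : DeductivelyClosed S
  ⊢-closed = Θ⊆⇒deductivelyClosed {F = ξ} or₁ Θ⊆S
  ξ-step : ∀ φ → ξ S (# φ) → S (# φ)
  ξ-step φ x = Θ⊆S (# φ , x , ⇒-Pr (⇒-refl φ))
  go : ξ* S ⊆ S
  go (lit (φ , l , refl)) = ξ-step φ (lit (φ , l , refl))
  go (or₁ φ ψ s) = ξ-step (φ ⋁ ψ) (or₁ φ ψ s)
  go (or₂ φ ψ s) = ξ-step (φ ⋁ ψ) (or₂ φ ψ s)
  go (and φ ψ s s′) = ξ-step (φ ⋀ ψ) (and φ ψ s s′)
  go (all v φ f) = ξ-step (∀' v φ) (all v φ (λ z → f (numeral z) (numeral-closed z)))
  go (ex v φ t c s) = ⊢-closed (∃-intro φ v t (freeFor-closed c v φ)) s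
  go (tr t c s) = ξ-step (Tr t) (tr t c s)
  go (ntr t c s) = ξ-step (∼ Tr t) (ntr t c s)
  go (untr t c sent s) =
    Tr-down {S = S} down sent (⊢-closed (to-numeral {t} {Tr (var 0)} {0} c) s)
  go (unntr t c sent s) =
    ∼Tr-down {S = S} {m = t °} ¬down sent (⊢-closed (to-numeral {t} {∼ Tr (var 0)} {0} c) s)

lemma6p10 : ((S : ℕ → Set) → S ≐ˢ Θ* S → S ≐ˢ Θ S)
            × ((S : ℕ → Set) → S ≐ˢ Θ S → TrDownClosed S → ¬TrDownClosed S → S ≐ˢ Θ* S)
lemma6p10 =
    (λ S fix → fixed-point-transfer {F = ξ} {G = ξ*} or₁ or₁ fix (Θ*⊆⇒ξ⊆ (≐ˢ-⊇ fix)))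
  , (λ S fix down ¬down →
       fixed-point-transfer {F = ξ*} {G = ξ} or₁ or₁ fix (Θ⊆⇒ξ*⊆ (≐ˢ-⊇ fix) down ¬down))
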